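{- Let $\alpha,\beta$ be ribbons and $D$ a skew diagram. Then $\alpha\bullet(\beta\bullet D)=(\alpha\bullet\beta)\bullet D$.
   Context: Skew diagrams are taken in English convention, considered up to translation, and $D^t$ is the transpose of $D$. For skew diagrams $D_1,D_2$, the disjoint union $D_1\oplus D_2$ places $D_1$ strictly north-east of $D_2$ with no common row or column, the bottom row of $D_1$ directly above the top row of $D_2$ and the leftmost column of $D_1$ directly right of the rightmost column of $D_2$. Concatenation $D_1\cdot D_2$ moves all cells of $D_1$ in $D_1\oplus D_2$ one cell west; near concatenation $D_1\odot D_2$ moves them one cell south. These operations are associative and associate with each other. A ribbon is a connected skew diagram with no $2\times2$ block. A ribbon with $k$ cells is uniquely $\square\bigstar_1\square\cdots\bigstar_{k-1}\square$ with $\square$ a single cell and $\bigstar_i\in\{\cdot,\odot\}$. For such a ribbon $\alpha$ and a skew diagram $D$, $\alpha\bullet D=D_1\bigstar_1D_2\bigstar_2\cdots\bigstar_{k-1}D_k$, where $D_i=D$ for odd $i$ and $D_i=D^t$ for even $i$. Note that $\beta\bullet D$ is a skew diagram and $\alpha\bullet\beta$ is a ribbon. -}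

module Defs where

open import Data.Nat as ℕ using (ℕ; zero; suc)
open import Data.Integer using (ℤ; +_; _+_; _-_; _⊓_; _⊔_; -_)
open import Data.Bool using (Bool; true; false; not; if_then_else_)
open import Data.List using (List; []; _∷_; _++_; map; foldr)
open import Data.List.Membership.Propositional using (_∈_)
open import Data.List.Relation.Unary.Linked using (Linked)
open import Data.Product using (Σ; _×_; _,_; ∃; ∃-syntax)
open import Relation.Binary.PropositionalEquality using (_≡_; _≢_)

-- Cells and diagrams (English convention).
-- A cell is (row , column); rows increase to the SOUTH, columns to the EAST.

Cell : Set
Cell = ℤ × ℤ

-- A (finite) diagram is given by a list of its cells (duplicates and order
-- irrelevant: only membership is ever used).
Diagram : Set
Diagram = List Cell

shift : ℤ → ℤ → Cell → Cell
shift a b (r , c) = (r + a , c + b)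

shiftD : ℤ → ℤ → Diagram → Diagram
shiftD a b = map (shift a b)

infix 4 _≈_
_≈_ : Diagram → Diagram → Set
D ≈ E = Σ ℤ λ a → Σ ℤ λ b → (∀ x → (x ∈ D → shift a b x ∈ E) × (shift a b x ∈ E → x ∈ D))

Partition : Set
Partition = List ℕ

IsPartition : Partition → Set
IsPartition λ′ = Linked (λ x y → y ℕ.≤ x) λ′

part : Partition → ℕ → ℕ
part []       _       = 0
part (x ∷ _)  zero    = x
part (_ ∷ xs) (suc i) = part xs i

-- D is a skew diagram: a translate of λ/μ for partitions μ ⊆ λ.
IsSkewDiagram : Diagram → Set
IsSkewDiagram D =
  Σ Partition λ lam → Σ Partition λ mu → Σ ℤ λ a → Σ ℤ λ b →
    IsPartition lam × IsPartition mu × (∀ i → part mu i ℕ.≤ part lam i) ×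
    (∀ r c → ((r , c) ∈ D →
                ∃[ i ] ∃[ j ] (r ≡ a + + i × c ≡ b + + j × part mu i ℕ.≤ j × j ℕ.< part lam i))
           × (∃[ i ] ∃[ j ] (r ≡ a + + i × c ≡ b + + j × part mu i ℕ.≤ j × j ℕ.< part lam i)
                → (r , c) ∈ D))

-- Extents (only meaningful for nonempty diagrams).

minOf maxOf : (Cell → ℤ) → Diagram → ℤ
minOf f []       = + 0
minOf f (x ∷ xs) = foldr (λ y m → f y ⊓ m) (f x) xs
maxOf f []       = + 0
maxOf f (x ∷ xs) = foldr (λ y m → f y ⊔ m) (f x) xs

row col : Cell → ℤ
row (r , _) = r
col (_ , c) = c

topRow bottomRow leftCol rightCol : Diagram → ℤ
topRow    = minOf row
bottomRow = maxOf row
leftCol   = minOf col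
rightCol  = maxOf col

transposeCell : Cell → Cell
transposeCell (r , c) = (c , r)

_ᵗ : Diagram → Diagram
D ᵗ = map transposeCell D

-- D₁ ⊕ D₂ : bottom row of D₁ directly above top row of D₂,
-- leftmost column of D₁ directly right of rightmost column of D₂.
_⊕_ : Diagram → Diagram → Diagram
D₁ ⊕ D₂ = shiftD (topRow D₂ - + 1 - bottomRow D₁) (rightCol D₂ + + 1 - leftCol D₁) D₁ ++ D₂

-- D₁ · D₂ : cells of D₁ in D₁ ⊕ D₂ moved one cell west.
_·_ : Diagram → Diagram → Diagram
D₁ · D₂ = shiftD (topRow D₂ - + 1 - bottomRow D₁) (rightCol D₂ - leftCol D₁) D₁ ++ D₂

-- D₁ ⊙ D₂ : cells of D₁ in D₁ ⊕ D₂ moved one cell south.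
_⊙_ : Diagram → Diagram → Diagram
D₁ ⊙ D₂ = shiftD (topRow D₂ - bottomRow D₁) (rightCol D₂ + + 1 - leftCol D₁) D₁ ++ D₂

-- Ribbons, encoded by their (unique) word ★₁ … ★_{k-1} in {·, ⊙}.

data Star : Set where
  cdot odot : Star

RibbonWord : Set
RibbonWord = List Star

applyStar : Star → Diagram → Diagram → Diagram
applyStar cdot = _·_
applyStar odot = _⊙_

-- D₁ ★₁ D₂ ★₂ ⋯ ★_{k-1} D_k with D_i = D (i odd), Dᵗ (i even);
-- the flag says whether the current factor has odd index.
bulletAux : Bool → RibbonWord → Diagram → Diagram
bulletAux odd []      D = if odd then D else D ᵗ
bulletAux odd (s ∷ w) D = applyStar s (if odd then D else D ᵗ) (bulletAux (not odd) w D)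

infixr 6 _•_
_•_ : RibbonWord → Diagram → Diagram
w • D = bulletAux true w D

□ : Diagram
□ = (+ 0 , + 0) ∷ []

ribbon : RibbonWord → Diagram
ribbon w = w • □

-- A star product X ★ Y (★ ∈ {·, ⊙}) is Y together with a translate of X whose
-- offset depends only on the extreme rows and columns of X and Y. Hence ★ respects translation,
-- is associative, and (X ★ Y)ᵗ is a translate of Yᵗ ★′ Xᵗ, where ★′ exchanges · and ⊙; so the
-- transpose of a bullet product with word u is a bullet product with the reversed, exchanged
-- word. Expanding each factor β • D or (β • D)ᵗ of α • (β • D) in this way and regluing by
-- associativity shows that α • (β • D) is a translate of w • D for an explicit word w = α •ʷ β.
-- Taking D = □, ribbon γ is then a translate of ribbon w. A ribbon word can be read off its
-- diagram by walking from the north-east corner, stepping south for · and west for ⊙; this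
-- reading is translation invariant, so γ = w.
module Submission where

open import Algebra.Bundles using (AbelianGroup; CommutativeMonoid)
import Algebra.Properties.Group as GroupProperties
open import Data.Bool using (Bool; true; false; not; if_then_else_)
open import Data.Bool.Properties using (not-involutive)
open import Data.Empty using (⊥-elim)
open import Data.Integer as ℤ using (ℤ; +_; _+_; _-_; _⊓_; _⊔_; -_; _≤_)
import Data.Integer.Properties as ℤ
open import Data.Integer.Tactic.RingSolver using (solve-∀)
open import Data.List using (List; []; _∷_; _++_; map; foldr; length)
open import Data.List.Properties using (map-++; map-∘; map-cong; map-id; ++-assoc)
open import Data.List.Membership.Propositional using (_∈_)
open import Data.List.Membership.Propositional.Properties using (∈-map⁺; ∈-map⁻; ∈-++⁺ˡ; ∈-++⁺ʳ; ∈-++⁻)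
open import Data.List.Relation.Binary.BagAndSetEquality using (set; _∼[_]_; [_]-Equality; ++-cong; commutativeMonoid)
import Data.List.Relation.Binary.BagAndSetEquality as SetEquality
open import Data.List.Relation.Unary.Any using (here; there)
open import Data.Nat as ℕ using (ℕ; zero; suc)
import Data.Nat.Properties as ℕ
open import Data.Product using (∃; _×_; _,_; proj₁; proj₂)
open import Data.Product.Properties using (≡-dec)
open import Data.List.Membership.DecPropositional (≡-dec ℤ._≟_ ℤ._≟_) using (_∈?_)
open import Data.Sum using (_⊎_; inj₁; inj₂)
open import Function.Bundles using (Equivalence; mk⇔)
open import Level using (0ℓ)
open import Relation.Binary.Bundles using (Setoid; Preorder)
open import Relation.Binary.Structures using (IsPartialOrder; IsPreorder)
import Relation.Binary.Properties.Poset as PosetProperties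
import Relation.Binary.Reasoning.Preorder as PreorderReasoning
import Relation.Binary.Reasoning.Setoid as SetoidReasoning
open import Relation.Binary.PropositionalEquality
open import Relation.Nullary using (¬_; yes; no; does)
open import Relation.Nullary.Decidable using (dec-true; dec-false)

open import Defs

module Extremum
  {_≼_ : ℤ → ℤ → Set} (≼-isPartialOrder : IsPartialOrder _≡_ _≼_)
  (+-monoˡ-≼ : ∀ k {i j} → i ≼ j → (i + k) ≼ (j + k))
  (_∙_ : ℤ → ℤ → ℤ) (∙-sel : ∀ i j → i ∙ j ≡ i ⊎ i ∙ j ≡ j)
  (∙-≼ˡ : ∀ i j → (i ∙ j) ≼ i) (∙-≼ʳ : ∀ i j → (i ∙ j) ≼ j)
  where

  open IsPartialOrder ≼-isPartialOrder using ()
    renaming (refl to ≼-refl; trans to ≼-trans; antisym to ≼-antisym)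

  IsExtremum : (Cell → ℤ) → Diagram → ℤ → Set
  IsExtremum f D m = (∃ λ x → x ∈ D × f x ≡ m) × (∀ x → x ∈ D → m ≼ f x)

  module _ {f : Cell → ℤ} where

    unique : ∀ {D m m′} → IsExtremum f D m → IsExtremum f D m′ → m ≡ m′
    unique ((x , x∈ , refl) , m≼) ((x′ , x′∈ , refl) , m′≼) = ≼-antisym (m≼ x′ x′∈) (m′≼ x x∈)

    foldr-extremum : ∀ x xs → IsExtremum f (x ∷ xs) (foldr (λ y m → f y ∙ m) (f x) xs)
    foldr-extremum x []       = (x , here refl , refl) , λ { _ (here refl) → ≼-refl }
    foldr-extremum x (y ∷ ys) with foldr-extremum x ys
    ... | (z , z∈ , fz) , m≼ = attained , bound
      where
      m = foldr (λ y m → f y ∙ m) (f x) ys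
      attained : ∃ λ z → z ∈ x ∷ y ∷ ys × f z ≡ f y ∙ m
      attained with ∙-sel (f y) m
      ... | inj₁ e = y , there (here refl) , sym e
      ... | inj₂ e = z , skip z∈ , trans fz (sym e)
        where
        skip : ∀ {w} → w ∈ x ∷ ys → w ∈ x ∷ y ∷ ys
        skip (here p)  = here p
        skip (there p) = there (there p)
      bound : ∀ w → w ∈ x ∷ y ∷ ys → (f y ∙ m) ≼ f w
      bound w (here refl)         = ≼-trans (∙-≼ʳ (f y) m) (m≼ w (here refl))
      bound w (there (here refl)) = ∙-≼ˡ (f y) m
      bound w (there (there p))   = ≼-trans (∙-≼ʳ (f y) m) (m≼ w (there p))

    resp-∼ : ∀ {D E m} → D ∼[ set ] E → IsExtremum f D m → IsExtremum f E m
    resp-∼ D∼E ((x , x∈ , fx) , m≼) =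
      (x , Equivalence.to D∼E x∈ , fx) , λ y y∈ → m≼ y (Equivalence.from D∼E y∈)

    +⁺ : ∀ {D m} c → IsExtremum f D m → IsExtremum (λ x → f x + c) D (m + c)
    +⁺ c ((x , x∈ , refl) , m≼) = (x , x∈ , refl) , λ y y∈ → +-monoˡ-≼ c (m≼ y y∈)

    ++⁺ˡ : ∀ {A B m n} → IsExtremum f A m → IsExtremum f B n → m ≼ n → IsExtremum f (A ++ B) m
    ++⁺ˡ {A} ((x , x∈ , fx) , m≼) (_ , n≼) m≼n = (x , ∈-++⁺ˡ x∈ , fx) , bound
      where
      bound : ∀ y → y ∈ A ++ _ → _ ≼ f y
      bound y y∈ with ∈-++⁻ A y∈
      ... | inj₁ p = m≼ y p
      ... | inj₂ p = ≼-trans m≼n (n≼ y p)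

    ++⁺ʳ : ∀ {A B m n} → IsExtremum f A m → IsExtremum f B n → n ≼ m → IsExtremum f (A ++ B) n
    ++⁺ʳ {A} (_ , m≼) ((x , x∈ , fx) , n≼) n≼m = (x , ∈-++⁺ʳ A x∈ , fx) , bound
      where
      bound : ∀ y → y ∈ A ++ _ → _ ≼ f y
      bound y y∈ with ∈-++⁻ A y∈
      ... | inj₁ p = ≼-trans n≼m (m≼ y p)
      ... | inj₂ p = n≼ y p

  map⁺ : ∀ {f k D m} (g : Cell → Cell) → (∀ x → f (g x) ≡ k x) →
         IsExtremum k D m → IsExtremum f (map g D) m
  map⁺ {f} {k} {D} g fg≗k ((x , x∈ , refl) , m≼) = (g x , ∈-map⁺ g x∈ , fg≗k x) , bound
    where
    bound : ∀ y → y ∈ map g D → k x ≼ f y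
    bound y y∈ with ∈-map⁻ g y∈
    ... | z , z∈ , refl = subst (k x ≼_) (sym (fg≗k z)) (m≼ z z∈)

module Min = Extremum ℤ.≤-isPartialOrder ℤ.+-monoˡ-≤ _⊓_ ℤ.⊓-sel ℤ.i⊓j≤i ℤ.i⊓j≤j
module Max = Extremum (PosetProperties.≥-isPartialOrder ℤ.≤-poset) (λ k → ℤ.+-monoˡ-≤ k)
                      _⊔_ ℤ.⊔-sel ℤ.i≤i⊔j ℤ.i≤j⊔i

min≤max : ∀ {f D m M} → Min.IsExtremum f D m → Max.IsExtremum f D M → m ≤ M
min≤max ((x , x∈ , refl) , _) (_ , M≥) = M≥ x x∈

NonEmpty : Diagram → Set
NonEmpty D = ∃ (_∈ D)

record Box : Set where
  constructor box
  field top bottom left right : ℤ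

open Box

extent : Diagram → Box
extent D = box (topRow D) (bottomRow D) (leftCol D) (rightCol D)

HasExtent : Diagram → Box → Set
HasExtent D B = Min.IsExtremum row D (top B) × Max.IsExtremum row D (bottom B)
              × Min.IsExtremum col D (left B) × Max.IsExtremum col D (right B)

shiftBox : ℤ → ℤ → Box → Box
shiftBox a b (box t u l r) = box (t + a) (u + a) (l + b) (r + b)

transposeBox : Box → Box
transposeBox (box t u l r) = box l r t u

hasExtent-extent : ∀ {D} → NonEmpty D → HasExtent D (extent D)
hasExtent-extent {[]}     (_ , ())
hasExtent-extent {x ∷ xs} _ = Min.foldr-extremum {f = row} x xs , Max.foldr-extremum {f = row} x xs
                            , Min.foldr-extremum {f = col} x xs , Max.foldr-extremum {f = col} x xs

module _ {D : Diagram} where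

  hasExtent⇒extent≡ : ∀ {B} → HasExtent D B → extent D ≡ B
  hasExtent⇒extent≡ h@(((x , x∈ , _) , _) , _) = unique (hasExtent-extent (x , x∈)) h
    where
    unique : ∀ {B B′} → HasExtent D B → HasExtent D B′ → B ≡ B′
    unique {box _ _ _ _} {box _ _ _ _} (t , u , l , r) (t′ , u′ , l′ , r′)
      with refl ← Min.unique t t′ | refl ← Max.unique u u′
         | refl ← Min.unique l l′ | refl ← Max.unique r r′ = refl

  top≤bottom : ∀ {B} → HasExtent D B → top B ≤ bottom B
  top≤bottom (t , u , _ , _) = min≤max t u

  left≤right : ∀ {B} → HasExtent D B → left B ≤ right B
  left≤right (_ , _ , l , r) = min≤max l r

  hasExtent-resp : ∀ {E B} → D ∼[ set ] E → HasExtent D B → HasExtent E B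
  hasExtent-resp D∼E (t , u , l , r) =
    Min.resp-∼ D∼E t , Max.resp-∼ D∼E u , Min.resp-∼ D∼E l , Max.resp-∼ D∼E r

  hasExtent-shift : ∀ {B} a b → HasExtent D B → HasExtent (shiftD a b D) (shiftBox a b B)
  hasExtent-shift a b (t , u , l , r) =
    Min.map⁺ (shift a b) (λ _ → refl) (Min.+⁺ a t) , Max.map⁺ (shift a b) (λ _ → refl) (Max.+⁺ a u) ,
    Min.map⁺ (shift a b) (λ _ → refl) (Min.+⁺ b l) , Max.map⁺ (shift a b) (λ _ → refl) (Max.+⁺ b r)

  hasExtent-ᵗ : ∀ {B} → HasExtent D B → HasExtent (D ᵗ) (transposeBox B)
  hasExtent-ᵗ (t , u , l , r) =
    Min.map⁺ transposeCell (λ _ → refl) l , Max.map⁺ transposeCell (λ _ → refl) r ,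
    Min.map⁺ transposeCell (λ _ → refl) t , Max.map⁺ transposeCell (λ _ → refl) u

extent-ᵗ : ∀ {D} → NonEmpty D → extent (D ᵗ) ≡ transposeBox (extent D)
extent-ᵗ ne = hasExtent⇒extent≡ (hasExtent-ᵗ (hasExtent-extent ne))

-- Star operations as translations

rowGap colGap : Star → ℕ
rowGap cdot = 1
rowGap odot = 0
colGap cdot = 0
colGap odot = 1

rowOffset colOffset : Star → Box → Box → ℤ
rowOffset s X Y = top Y - + rowGap s - bottom X
colOffset s X Y = right Y + + colGap s - left X

starBox : Star → Box → Box → Box
starBox s X Y = box (top X + rowOffset s X Y) (bottom Y) (left Y) (right X + colOffset s X Y)

applyStar-shift : ∀ s X Y → applyStar s X Y ≡
  shiftD (rowOffset s (extent X) (extent Y)) (colOffset s (extent X) (extent Y)) X ++ Y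
applyStar-shift cdot X Y =
  cong (λ c → shiftD (topRow Y - + 1 - bottomRow X) (c - leftCol X) X ++ Y) (sym (ℤ.+-identityʳ (rightCol Y)))
applyStar-shift odot X Y =
  cong (λ r → shiftD (r - bottomRow X) (rightCol Y + + 1 - leftCol X) X ++ Y) (sym (ℤ.+-identityʳ (topRow Y)))

module _ (s : Star) (X Y : Box) where

  bottom+rowOffset : bottom X + rowOffset s X Y ≡ top Y - + rowGap s
  bottom+rowOffset = lemma (top Y) (+ rowGap s) (bottom X)
    where lemma : ∀ t g u → u + (t - g - u) ≡ t - g
          lemma = solve-∀

  left+colOffset : left X + colOffset s X Y ≡ right Y + + colGap s
  left+colOffset = lemma (right Y) (+ colGap s) (left X)
    where lemma : ∀ r g l → l + (r + g - l) ≡ r + g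
          lemma = solve-∀

  open ℤ.≤-Reasoning

  starBox-top≤ : top X ≤ bottom X → top X + rowOffset s X Y ≤ top Y
  starBox-top≤ t≤u = begin
    top X + rowOffset s X Y     ≤⟨ ℤ.+-monoˡ-≤ (rowOffset s X Y) t≤u ⟩
    bottom X + rowOffset s X Y  ≡⟨ bottom+rowOffset ⟩
    top Y - + rowGap s          ≤⟨ ℤ.i-j≤i (top Y) (+ rowGap s) ⟩
    top Y                       ∎

  starBox-bottom≤ : top Y ≤ bottom Y → bottom X + rowOffset s X Y ≤ bottom Y
  starBox-bottom≤ t≤u = begin
    bottom X + rowOffset s X Y  ≡⟨ bottom+rowOffset ⟩
    top Y - + rowGap s          ≤⟨ ℤ.i-j≤i (top Y) (+ rowGap s) ⟩
    top Y                       ≤⟨ t≤u ⟩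
    bottom Y                    ∎

  starBox-left≤ : left Y ≤ right Y → left Y ≤ left X + colOffset s X Y
  starBox-left≤ l≤r = begin
    left Y                      ≤⟨ l≤r ⟩
    right Y                     ≤⟨ ℤ.i≤i+j (right Y) (+ colGap s) ⟩
    right Y + + colGap s        ≡⟨ left+colOffset ⟨
    left X + colOffset s X Y    ∎

  starBox-right≤ : left X ≤ right X → right Y ≤ right X + colOffset s X Y
  starBox-right≤ l≤r = begin
    right Y                     ≤⟨ ℤ.i≤i+j (right Y) (+ colGap s) ⟩
    right Y + + colGap s        ≡⟨ left+colOffset ⟨
    left X + colOffset s X Y    ≤⟨ ℤ.+-monoˡ-≤ (colOffset s X Y) l≤r ⟩
    right X + colOffset s X Y   ∎

hasExtent-star : ∀ s {X Y} → NonEmpty X → NonEmpty Y →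
                 HasExtent (applyStar s X Y) (starBox s (extent X) (extent Y))
hasExtent-star s {X} {Y} neX neY =
  subst (λ Z → HasExtent Z (starBox s BX BY)) (sym (applyStar-shift s X Y))
    (glue (hasExtent-shift (rowOffset s BX BY) (colOffset s BX BY) hX) hY)
  where
  BX = extent X
  BY = extent Y
  hX = hasExtent-extent neX
  hY = hasExtent-extent neY
  glue : ∀ {X′} → HasExtent X′ (shiftBox (rowOffset s BX BY) (colOffset s BX BY) BX) →
         HasExtent Y BY → HasExtent (X′ ++ Y) (starBox s BX BY)
  glue (tX , uX , lX , rX) (tY , uY , lY , rY) =
    Min.++⁺ˡ tX tY (starBox-top≤ s BX BY (top≤bottom hX)) ,
    Max.++⁺ʳ uX uY (starBox-bottom≤ s BX BY (top≤bottom hY)) ,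
    Min.++⁺ʳ lX lY (starBox-left≤ s BX BY (left≤right hY)) ,
    Max.++⁺ˡ rX rY (starBox-right≤ s BX BY (left≤right hX))

extent-star : ∀ s {X Y} → NonEmpty X → NonEmpty Y → extent (applyStar s X Y) ≡ starBox s (extent X) (extent Y)
extent-star s neX neY = hasExtent⇒extent≡ (hasExtent-star s neX neY)

nonEmpty-star : ∀ s X {Y} → NonEmpty Y → NonEmpty (applyStar s X Y)
nonEmpty-star s X {Y} (y , y∈) = y , subst (y ∈_) (sym (applyStar-shift s X Y)) (∈-++⁺ʳ _ y∈)

swap : Star → Star
swap cdot = odot
swap odot = cdot

rowGap-swap : ∀ s → rowGap (swap s) ≡ colGap s
rowGap-swap cdot = refl
rowGap-swap odot = refl

colGap-swap : ∀ s → colGap (swap s) ≡ rowGap s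
colGap-swap cdot = refl
colGap-swap odot = refl

module _ (s : Star) (X Y : Box) where

  rowOffset-shiftBox : ∀ a b c d → a + rowOffset s (shiftBox a b X) (shiftBox c d Y) ≡ rowOffset s X Y + c
  rowOffset-shiftBox a _ c _ = lemma (top Y) (+ rowGap s) (bottom X) a c
    where lemma : ∀ t g u a c → a + (t + c - g - (u + a)) ≡ t - g - u + c
          lemma = solve-∀

  colOffset-shiftBox : ∀ a b c d → b + colOffset s (shiftBox a b X) (shiftBox c d Y) ≡ colOffset s X Y + d
  colOffset-shiftBox _ b _ d = lemma (right Y) (+ colGap s) (left X) b d
    where lemma : ∀ r g l b d → b + (r + d + g - (l + b)) ≡ r + g - l + d
          lemma = solve-∀

  rowOffset-+ : ∀ p → rowOffset s X Y + p ≡ rowOffset s X (record Y { top = top Y + p })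
  rowOffset-+ p = lemma (top Y) (+ rowGap s) (bottom X) p
    where lemma : ∀ t g u p → t - g - u + p ≡ t + p - g - u
          lemma = solve-∀

  colOffset-+ : ∀ q → colOffset s X Y + q ≡ colOffset s X (record Y { right = right Y + q })
  colOffset-+ q = lemma (right Y) (+ colGap s) (left X) q
    where lemma : ∀ r g l q → r + g - l + q ≡ r + q + g - l
          lemma = solve-∀

  colOffset+rowOffset-swap : colOffset s X Y + rowOffset (swap s) (transposeBox Y) (transposeBox X) ≡ + 0
  colOffset+rowOffset-swap rewrite rowGap-swap s = lemma (right Y) (+ colGap s) (left X)
    where lemma : ∀ r g l → r + g - l + (l - g - r) ≡ + 0
          lemma = solve-∀

  rowOffset+colOffset-swap : rowOffset s X Y + colOffset (swap s) (transposeBox Y) (transposeBox X) ≡ + 0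
  rowOffset+colOffset-swap rewrite colGap-swap s = lemma (top Y) (+ rowGap s) (bottom X)
    where lemma : ∀ t g u → t - g - u + (u + g - t) ≡ + 0
          lemma = solve-∀

shift-injective : ∀ a b {x y} → shift a b x ≡ shift a b y → x ≡ y
shift-injective a b {x} {y} eq =
  cong₂ _,_ (∙-cancelʳ a (row x) (row y) (cong row eq)) (∙-cancelʳ b (col x) (col y) (cong col eq))
  where open GroupProperties (AbelianGroup.group ℤ.+-0-abelianGroup) using (∙-cancelʳ)

shift-shift-neg : ∀ a b x → shift a b (shift (- a) (- b) x) ≡ x
shift-shift-neg a b x = cong₂ _,_ (lemma (row x) a) (lemma (col x) b)
  where lemma : ∀ i a → i + - a + a ≡ i
        lemma = solve-∀

shiftD-identity : ∀ D → shiftD (+ 0) (+ 0) D ≡ D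
shiftD-identity D = trans (map-cong (λ x → cong₂ _,_ (ℤ.+-identityʳ (row x)) (ℤ.+-identityʳ (col x))) D) (map-id D)

shiftD-shiftD : ∀ a b c d D → shiftD a b (shiftD c d D) ≡ shiftD (c + a) (d + b) D
shiftD-shiftD a b c d D =
  trans (sym (map-∘ D)) (map-cong (λ x → cong₂ _,_ (ℤ.+-assoc (row x) c a) (ℤ.+-assoc (col x) d b)) D)

shiftD-cong : ∀ {a a′ b b′} D → a ≡ a′ → b ≡ b′ → shiftD a b D ≡ shiftD a′ b′ D
shiftD-cong D refl refl = refl

ᵗ-shiftD : ∀ a b D → shiftD a b D ᵗ ≡ shiftD b a (D ᵗ)
ᵗ-shiftD a b D = trans (sym (map-∘ D)) (map-∘ D)

ᵗ-involutive : ∀ D → D ᵗ ᵗ ≡ D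
ᵗ-involutive D = trans (sym (map-∘ D)) (map-id D)

∈-shiftD⁻ : ∀ a b {x D} → shift a b x ∈ shiftD a b D → x ∈ D
∈-shiftD⁻ a b p with ∈-map⁻ (shift a b) p
... | y , y∈ , eq = subst (_∈ _) (sym (shift-injective a b eq)) y∈

module ∼set = Setoid ([ set ]-Equality Cell)

infix 4 _~_
_~_ : Diagram → Diagram → Set
D ~ E = ∃ λ a → ∃ λ b → E ∼[ set ] shiftD a b D

~-reflexive : ∀ {D E} → D ≡ E → D ~ E
~-reflexive {D} refl = + 0 , + 0 , ∼set.reflexive (sym (shiftD-identity D))

~-trans : ∀ {D E F} → D ~ E → E ~ F → D ~ F
~-trans {D} {E} {F} (a , b , E∼) (c , d , F∼) = a + c , b + d , (begin
  F                             ≈⟨ F∼ ⟩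
  shiftD c d E                  ≈⟨ SetEquality.map-cong (λ _ → refl) E∼ ⟩
  shiftD c d (shiftD a b D)     ≡⟨ shiftD-shiftD c d a b D ⟩
  shiftD (a + c) (b + d) D      ∎)
  where open SetoidReasoning ([ set ]-Equality Cell)

~-isPreorder : IsPreorder _≡_ _~_
~-isPreorder = record { isEquivalence = isEquivalence ; reflexive = ~-reflexive ; trans = ~-trans }

~-preorder : Preorder 0ℓ 0ℓ 0ℓ
~-preorder = record { isPreorder = ~-isPreorder }

open IsPreorder ~-isPreorder public using () renaming (refl to ~-refl)

module ~-Reasoning = PreorderReasoning ~-preorder

≈⇒~ : ∀ {D E} → D ≈ E → D ~ E
≈⇒~ {D} {E} (a , b , h) = a , b , mk⇔ to from
  where
  to : ∀ {x} → x ∈ E → x ∈ shiftD a b D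
  to {x} x∈ = subst (_∈ shiftD a b D) (shift-shift-neg a b x)
    (∈-map⁺ (shift a b) (proj₂ (h (shift (- a) (- b) x)) (subst (_∈ E) (sym (shift-shift-neg a b x)) x∈)))
  from : ∀ {x} → x ∈ shiftD a b D → x ∈ E
  from x∈ with ∈-map⁻ (shift a b) x∈
  ... | y , y∈ , refl = proj₁ (h y) y∈

~⇒≈ : ∀ {D E} → D ~ E → D ≈ E
~⇒≈ (a , b , E∼) = a , b , λ x →
  (λ x∈ → Equivalence.from E∼ (∈-map⁺ (shift a b) x∈)) , (λ x∈ → ∈-shiftD⁻ a b (Equivalence.to E∼ x∈))

extent-~ : ∀ {D E} → ((a , b , _) : D ~ E) → NonEmpty D → extent E ≡ shiftBox a b (extent D)
extent-~ (a , b , E∼) ne = hasExtent⇒extent≡ (hasExtent-resp (∼set.sym E∼) (hasExtent-shift a b (hasExtent-extent ne)))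

-- Congruence, transposition and associativity of the star operations

applyStar-cong : ∀ s {X X′ Y Y′} → X ~ X′ → Y ~ Y′ → NonEmpty X → NonEmpty Y →
                 applyStar s X Y ~ applyStar s X′ Y′
applyStar-cong s {X} {X′} {Y} {Y′} X~X′@(a , b , X′∼) Y~Y′@(c , d , Y′∼) neX neY = c , d , (begin
  applyStar s X′ Y′                               ≡⟨ applyStar-shift s X′ Y′ ⟩
  shiftD r′ k′ X′ ++ Y′                           ≈⟨ ++-cong (SetEquality.map-cong (λ _ → refl) X′∼) Y′∼ ⟩
  shiftD r′ k′ (shiftD a b X) ++ shiftD c d Y     ≡⟨ cong (_++ shiftD c d Y) (shiftD-shiftD r′ k′ a b X) ⟩
  shiftD (a + r′) (b + k′) X ++ shiftD c d Y      ≡⟨ cong (_++ shiftD c d Y) (shiftD-cong X row-eq col-eq) ⟩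
  shiftD (r + c) (k + d) X ++ shiftD c d Y        ≡⟨ cong (_++ shiftD c d Y) (shiftD-shiftD c d r k X) ⟨
  shiftD c d (shiftD r k X) ++ shiftD c d Y       ≡⟨ map-++ (shift c d) (shiftD r k X) Y ⟨
  shiftD c d (shiftD r k X ++ Y)                  ≡⟨ cong (shiftD c d) (applyStar-shift s X Y) ⟨
  shiftD c d (applyStar s X Y)                    ∎)
  where
  open SetoidReasoning ([ set ]-Equality Cell)
  BX = extent X
  BY = extent Y
  r = rowOffset s BX BY
  k = colOffset s BX BY
  r′ = rowOffset s (extent X′) (extent Y′)
  k′ = colOffset s (extent X′) (extent Y′)
  shifted-extents : (extent X′ , extent Y′) ≡ (shiftBox a b BX , shiftBox c d BY)
  shifted-extents = cong₂ _,_ (extent-~ X~X′ neX) (extent-~ Y~Y′ neY)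
  row-eq : a + r′ ≡ r + c
  row-eq = trans (cong (λ (B , B′) → a + rowOffset s B B′) shifted-extents) (rowOffset-shiftBox s BX BY a b c d)
  col-eq : b + k′ ≡ k + d
  col-eq = trans (cong (λ (B , B′) → b + colOffset s B B′) shifted-extents) (colOffset-shiftBox s BX BY a b c d)

applyStar-ᵗ : ∀ s {X Y} → NonEmpty X → NonEmpty Y → applyStar s X Y ᵗ ~ applyStar (swap s) (Y ᵗ) (X ᵗ)
applyStar-ᵗ s {X} {Y} neX neY = r′ , k′ , (begin
  applyStar (swap s) (Y ᵗ) (X ᵗ)                         ≡⟨ applyStar-shift (swap s) (Y ᵗ) (X ᵗ) ⟩
  Y′ ++ X ᵗ                                              ≈⟨ CommutativeMonoid.comm (commutativeMonoid set Cell) Y′ (X ᵗ) ⟩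
  X ᵗ ++ Y′                                              ≡⟨ cong (_++ Y′) (shiftD-identity (X ᵗ)) ⟨
  shiftD (+ 0) (+ 0) (X ᵗ) ++ Y′                         ≡⟨ cong (_++ Y′) (shiftD-cong (X ᵗ) cancel-row cancel-col) ⟨
  shiftD (k + r′) (r + k′) (X ᵗ) ++ Y′                   ≡⟨ cong (_++ Y′) (shiftD-shiftD r′ k′ k r (X ᵗ)) ⟨
  shiftD r′ k′ (shiftD k r (X ᵗ)) ++ shiftD r′ k′ (Y ᵗ)  ≡⟨ map-++ (shift r′ k′) (shiftD k r (X ᵗ)) (Y ᵗ) ⟨
  shiftD r′ k′ (shiftD k r (X ᵗ) ++ Y ᵗ)                 ≡⟨ cong (λ Z → shiftD r′ k′ (Z ++ Y ᵗ)) (ᵗ-shiftD r k X) ⟨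
  shiftD r′ k′ (shiftD r k X ᵗ ++ Y ᵗ)                   ≡⟨ cong (shiftD r′ k′) (map-++ transposeCell (shiftD r k X) Y) ⟨
  shiftD r′ k′ ((shiftD r k X ++ Y) ᵗ)                   ≡⟨ cong (λ Z → shiftD r′ k′ (Z ᵗ)) (applyStar-shift s X Y) ⟨
  shiftD r′ k′ (applyStar s X Y ᵗ)                       ∎)
  where
  open SetoidReasoning ([ set ]-Equality Cell)
  r = rowOffset s (extent X) (extent Y)
  k = colOffset s (extent X) (extent Y)
  r′ = rowOffset (swap s) (extent (Y ᵗ)) (extent (X ᵗ))
  k′ = colOffset (swap s) (extent (Y ᵗ)) (extent (X ᵗ))
  Y′ = shiftD r′ k′ (Y ᵗ)
  transposed-extents : (extent (Y ᵗ) , extent (X ᵗ)) ≡ (transposeBox (extent Y) , transposeBox (extent X))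
  transposed-extents = cong₂ _,_ (extent-ᵗ neY) (extent-ᵗ neX)
  cancel-row : k + r′ ≡ + 0
  cancel-row = trans (cong (λ (B , B′) → k + rowOffset (swap s) B B′) transposed-extents)
                     (colOffset+rowOffset-swap s (extent X) (extent Y))
  cancel-col : r + k′ ≡ + 0
  cancel-col = trans (cong (λ (B , B′) → r + colOffset (swap s) B B′) transposed-extents)
                     (rowOffset+colOffset-swap s (extent X) (extent Y))

applyStar-assoc : ∀ s t {X Y Z} → NonEmpty X → NonEmpty Y → NonEmpty Z →
                  applyStar t (applyStar s X Y) Z ≡ applyStar s X (applyStar t Y Z)
applyStar-assoc s t {X} {Y} {Z} neX neY neZ = begin
  applyStar t W Z                                        ≡⟨ applyStar-shift t W Z ⟩
  shiftD p q W ++ Z                                      ≡⟨ cong (λ B → shiftD (rowOffset t B BZ) (colOffset t B BZ) W ++ Z)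
                                                                  (extent-star s neX neY) ⟩
  shiftD p₀ q₀ W ++ Z                                    ≡⟨ cong (λ W → shiftD p₀ q₀ W ++ Z) (applyStar-shift s X Y) ⟩
  shiftD p₀ q₀ (shiftD r k X ++ Y) ++ Z                  ≡⟨ cong (_++ Z) (map-++ (shift p₀ q₀) (shiftD r k X) Y) ⟩
  (shiftD p₀ q₀ (shiftD r k X) ++ shiftD p₀ q₀ Y) ++ Z   ≡⟨ ++-assoc (shiftD p₀ q₀ (shiftD r k X)) _ Z ⟩
  shiftD p₀ q₀ (shiftD r k X) ++ V                       ≡⟨ cong (_++ V) (shiftD-shiftD p₀ q₀ r k X) ⟩
  shiftD (r + p₀) (k + q₀) X ++ V                        ≡⟨ cong (_++ V) (shiftD-cong X (rowOffset-+ s BX BY p₀)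
                                                                                         (colOffset-+ s BX BY q₀)) ⟩
  shiftD (rowOffset s BX BV) (colOffset s BX BV) X ++ V  ≡⟨ cong (λ B → shiftD (rowOffset s BX B) (colOffset s BX B) X ++ V)
                                                                  (extent-star t neY neZ) ⟨
  shiftD r′ k′ X ++ V                                    ≡⟨ cong (shiftD r′ k′ X ++_) (applyStar-shift t Y Z) ⟨
  shiftD r′ k′ X ++ applyStar t Y Z                      ≡⟨ applyStar-shift s X (applyStar t Y Z) ⟨
  applyStar s X (applyStar t Y Z)                        ∎
  where
  open ≡-Reasoning
  W = applyStar s X Y
  BX = extent X
  BY = extent Y
  BZ = extent Z
  BV = starBox t BY BZ
  r = rowOffset s BX BY
  k = colOffset s BX BY
  p = rowOffset t (extent W) BZ
  q = colOffset t (extent W) BZ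
  p₀ = rowOffset t BY BZ
  q₀ = colOffset t BY BZ
  r′ = rowOffset s BX (extent (applyStar t Y Z))
  k′ = colOffset s BX (extent (applyStar t Y Z))
  V = shiftD p₀ q₀ Y ++ Z

factor : Bool → Diagram → Diagram
factor odd D = if odd then D else D ᵗ

lastFactor : Bool → RibbonWord → Bool
lastFactor odd []      = odd
lastFactor odd (_ ∷ w) = lastFactor (not odd) w

transposeWord : RibbonWord → RibbonWord
transposeWord []      = []
transposeWord (s ∷ w) = transposeWord w ++ swap s ∷ []

lastFactor-not : ∀ odd w → lastFactor (not odd) w ≡ not (lastFactor odd w)
lastFactor-not odd []      = refl
lastFactor-not odd (_ ∷ w) = lastFactor-not (not odd) w

lastFactor-++ : ∀ odd u v → lastFactor odd (u ++ v) ≡ lastFactor (lastFactor odd u) v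
lastFactor-++ odd []      v = refl
lastFactor-++ odd (_ ∷ u) v = lastFactor-++ (not odd) u v

lastFactor-transposeWord : ∀ odd w → lastFactor odd (transposeWord w) ≡ lastFactor odd w
lastFactor-transposeWord odd []      = refl
lastFactor-transposeWord odd (s ∷ w) = begin
  lastFactor odd (transposeWord w ++ swap s ∷ [])    ≡⟨ lastFactor-++ odd (transposeWord w) (swap s ∷ []) ⟩
  not (lastFactor odd (transposeWord w))            ≡⟨ cong not (lastFactor-transposeWord odd w) ⟩
  not (lastFactor odd w)                            ≡⟨ lastFactor-not odd w ⟨
  lastFactor (not odd) w                            ∎
  where open ≡-Reasoning

lastFactor-involutive : ∀ odd w → lastFactor (lastFactor odd w) w ≡ odd
lastFactor-involutive odd []      = refl
lastFactor-involutive odd (_ ∷ w) = begin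
  lastFactor (not (lastFactor (not odd) w)) w  ≡⟨ lastFactor-not (lastFactor (not odd) w) w ⟩
  not (lastFactor (lastFactor (not odd) w) w)  ≡⟨ cong not (lastFactor-involutive (not odd) w) ⟩
  not (not odd)                                ≡⟨ not-involutive odd ⟩
  odd                                          ∎
  where open ≡-Reasoning

lastFactor-transposeWord-not : ∀ odd w → lastFactor (not (lastFactor odd w)) (transposeWord w) ≡ not odd
lastFactor-transposeWord-not odd w = begin
  lastFactor (not (lastFactor odd w)) (transposeWord w)  ≡⟨ lastFactor-transposeWord _ w ⟩
  lastFactor (not (lastFactor odd w)) w                  ≡⟨ lastFactor-not (lastFactor odd w) w ⟩
  not (lastFactor (lastFactor odd w) w)                  ≡⟨ cong not (lastFactor-involutive odd w) ⟩
  not odd                                                ∎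
  where open ≡-Reasoning

nonEmpty-factor : ∀ odd {D} → NonEmpty D → NonEmpty (factor odd D)
nonEmpty-factor true  ne       = ne
nonEmpty-factor false (x , x∈) = transposeCell x , ∈-map⁺ transposeCell x∈

nonEmpty-bulletAux : ∀ odd w {D} → NonEmpty D → NonEmpty (bulletAux odd w D)
nonEmpty-bulletAux odd []      ne = nonEmpty-factor odd ne
nonEmpty-bulletAux odd (s ∷ w) ne = nonEmpty-star s _ (nonEmpty-bulletAux (not odd) w ne)

factor-ᵗ : ∀ odd D → factor odd D ᵗ ~ factor (not odd) D
factor-ᵗ true  D = ~-refl
factor-ᵗ false D = ~-reflexive (ᵗ-involutive D)

applyStar-bulletAux : ∀ odd u t v {D} → NonEmpty D →
  applyStar t (bulletAux odd u D) (bulletAux (not (lastFactor odd u)) v D) ~ bulletAux odd (u ++ t ∷ v) D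
applyStar-bulletAux odd []      t v ne = ~-refl
applyStar-bulletAux odd (s ∷ u) t v {D} ne = begin
  applyStar t (applyStar s F (bulletAux (not odd) u D)) G  ≡⟨ applyStar-assoc s t neF (nonEmpty-bulletAux (not odd) u ne) neG ⟩
  applyStar s F (applyStar t (bulletAux (not odd) u D) G)  ≲⟨ applyStar-cong s ~-refl (applyStar-bulletAux (not odd) u t v ne) neF
                                                                (nonEmpty-star t _ neG) ⟩
  applyStar s F (bulletAux (not odd) (u ++ t ∷ v) D)       ∎
  where
  open ~-Reasoning
  F = factor odd D
  G = bulletAux (not (lastFactor (not odd) u)) v D
  neF = nonEmpty-factor odd ne
  neG = nonEmpty-bulletAux _ v ne

bulletAux-ᵗ : ∀ odd w {D} → NonEmpty D → bulletAux odd w D ᵗ ~ bulletAux (not (lastFactor odd w)) (transposeWord w) D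
bulletAux-ᵗ odd []      {D} ne = factor-ᵗ odd D
bulletAux-ᵗ odd (s ∷ w) {D} ne = begin
  applyStar s F B ᵗ                                    ≲⟨ applyStar-ᵗ s neF neB ⟩
  applyStar (swap s) (B ᵗ) (F ᵗ)                       ≲⟨ applyStar-cong (swap s) (bulletAux-ᵗ (not odd) w ne) (factor-ᵗ odd D)
                                                             (nonEmpty-factor false neB) (nonEmpty-factor false neF) ⟩
  applyStar (swap s) (bulletAux h T D) (factor (not odd) D)
                                                       ≡⟨ cong (λ o → applyStar (swap s) (bulletAux h T D) (factor o D)) parity ⟨
  applyStar (swap s) (bulletAux h T D) (factor (not (lastFactor h T)) D)
                                                       ≲⟨ applyStar-bulletAux h T (swap s) [] ne ⟩
  bulletAux h (T ++ swap s ∷ []) D                     ∎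
  where
  open ~-Reasoning
  F = factor odd D
  B = bulletAux (not odd) w D
  T = transposeWord w
  neF = nonEmpty-factor odd ne
  neB = nonEmpty-bulletAux (not odd) w ne
  h = not (lastFactor (not odd) w)
  parity : not (lastFactor h T) ≡ not odd
  parity = cong not (trans (lastFactor-transposeWord-not (not odd) w) (not-involutive odd))

-- Composition of bullet products

block : Bool → RibbonWord → RibbonWord
block odd β = if odd then β else transposeWord β

-- (β • D)ᵗ begins with the factor D exactly when β has odd length (see bulletAux-ᵗ).
blockStart : Bool → RibbonWord → Bool
blockStart odd β = if odd then true else not (lastFactor true β)

composeAux : Bool → RibbonWord → RibbonWord → RibbonWord
composeAux odd []      β = block odd β
composeAux odd (s ∷ α) β = block odd β ++ s ∷ composeAux (not odd) α β

infixr 6 _•ʷ_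
_•ʷ_ : RibbonWord → RibbonWord → RibbonWord
α •ʷ β = composeAux true α β

factor-bullet : ∀ odd β {D} → NonEmpty D → factor odd (β • D) ~ bulletAux (blockStart odd β) (block odd β) D
factor-bullet true  β ne = ~-refl
factor-bullet false β ne = bulletAux-ᵗ true β ne

blockStart-next : ∀ odd β → not (lastFactor (blockStart odd β) (block odd β)) ≡ blockStart (not odd) β
blockStart-next true  β = refl
blockStart-next false β = cong not (lastFactor-transposeWord-not true β)

bulletAux-assoc : ∀ odd α β {D} → NonEmpty D →
                   bulletAux odd α (β • D) ~ bulletAux (blockStart odd β) (composeAux odd α β) D
bulletAux-assoc odd []      β ne = factor-bullet odd β ne
bulletAux-assoc odd (s ∷ α) β {D} ne = begin
  applyStar s (factor odd (β • D)) (bulletAux (not odd) α (β • D))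
    ≲⟨ applyStar-cong s (factor-bullet odd β ne) (bulletAux-assoc (not odd) α β ne)
                        (nonEmpty-factor odd neβD) (nonEmpty-bulletAux (not odd) α neβD) ⟩
  applyStar s (bulletAux b (block odd β) D) (bulletAux (blockStart (not odd) β) (composeAux (not odd) α β) D)
    ≡⟨ cong (λ o → applyStar s (bulletAux b (block odd β) D) (bulletAux o (composeAux (not odd) α β) D))
            (blockStart-next odd β) ⟨
  applyStar s (bulletAux b (block odd β) D) (bulletAux (not (lastFactor b (block odd β))) (composeAux (not odd) α β) D)
    ≲⟨ applyStar-bulletAux b (block odd β) s (composeAux (not odd) α β) ne ⟩
  bulletAux b (block odd β ++ s ∷ composeAux (not odd) α β) D
    ∎
  where
  open ~-Reasoning
  b = blockStart odd β
  neβD = nonEmpty-bulletAux true β ne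

•-assoc : ∀ α β {D} → NonEmpty D → α • (β • D) ~ (α •ʷ β) • D
•-assoc α β = bulletAux-assoc true α β

-- Reading a ribbon word off its diagram

ribbonDiagram : RibbonWord → Diagram
ribbonDiagram []      = □
ribbonDiagram (s ∷ w) = applyStar s □ (ribbonDiagram w)

bulletAux-□ : ∀ odd w → bulletAux odd w □ ≡ ribbonDiagram w
bulletAux-□ true  []      = refl
bulletAux-□ false []      = refl
bulletAux-□ odd   (s ∷ w) = cong₂ (applyStar s) (factor-□ odd) (bulletAux-□ (not odd) w)
  where
  factor-□ : ∀ odd → factor odd □ ≡ □
  factor-□ true  = refl
  factor-□ false = refl

nonEmpty-ribbonDiagram : ∀ w → NonEmpty (ribbonDiagram w)
nonEmpty-ribbonDiagram []      = (+ 0 , + 0) , here refl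
nonEmpty-ribbonDiagram (s ∷ w) = nonEmpty-star s □ (nonEmpty-ribbonDiagram w)

corner : Diagram → Cell
corner D = (topRow D , rightCol D)

headCell : Star → RibbonWord → Cell
headCell s w = shift (rowOffset s (extent □) B) (colOffset s (extent □) B) (+ 0 , + 0)
  where B = extent (ribbonDiagram w)

ribbonDiagram-∷ : ∀ s w → ribbonDiagram (s ∷ w) ≡ headCell s w ∷ ribbonDiagram w
ribbonDiagram-∷ s w = applyStar-shift s □ (ribbonDiagram w)

corner-∷ : ∀ s w → corner (ribbonDiagram (s ∷ w)) ≡ headCell s w
corner-∷ s w = cong (λ B → (top B , right B)) (extent-star s (nonEmpty-ribbonDiagram []) (nonEmpty-ribbonDiagram w))

corner-∈ : ∀ w → corner (ribbonDiagram w) ∈ ribbonDiagram w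
corner-∈ []      = here refl
corner-∈ (s ∷ w) = subst₂ _∈_ (sym (corner-∷ s w)) (sym (ribbonDiagram-∷ s w)) (here refl)

south west : Cell → Cell
south (r , c) = (r + + 1 , c)
west  (r , c) = (r , c - + 1)

mem : Diagram → Cell → Bool
mem D x = does (x ∈? D)

mem-⇔ : ∀ {D E x y} → (x ∈ D → y ∈ E) → (y ∈ E → x ∈ D) → mem D x ≡ mem E y
mem-⇔ {D} {E} {x} {y} to from with x ∈? D
... | yes x∈ = sym (dec-true (y ∈? E) (to x∈))
... | no  x∉ = sym (dec-false (y ∈? E) (λ y∈ → x∉ (from y∈)))

readWord : ℕ → Diagram → Cell → RibbonWord
readWord zero    D p = []
readWord (suc n) D p =
  if mem D (south p) then cdot ∷ readWord n D (south p)
  else if mem D (west p) then odot ∷ readWord n D (west p)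
  else []

south-shift : ∀ a b p → south (shift a b p) ≡ shift a b (south p)
south-shift a b (r , _) = cong (_, _) (lemma r a)
  where lemma : ∀ r a → r + a + + 1 ≡ r + + 1 + a
        lemma = solve-∀

west-shift : ∀ a b p → west (shift a b p) ≡ shift a b (west p)
west-shift a b (_ , c) = cong (_ ,_) (lemma c b)
  where lemma : ∀ c b → c + b - + 1 ≡ c - + 1 + b
        lemma = solve-∀

mem-shift : ∀ {D E} a b → E ∼[ set ] shiftD a b D → ∀ q → mem E (shift a b q) ≡ mem D q
mem-shift a b E∼ q =
  mem-⇔ (λ q∈ → ∈-shiftD⁻ a b (Equivalence.to E∼ q∈)) (λ q∈ → Equivalence.from E∼ (∈-map⁺ (shift a b) q∈))

readWord-shift : ∀ n {D E} a b → E ∼[ set ] shiftD a b D → ∀ p → readWord n E (shift a b p) ≡ readWord n D p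
readWord-shift zero    a b E∼ p = refl
readWord-shift (suc n) a b E∼ p
  rewrite south-shift a b p | west-shift a b p | mem-shift a b E∼ (south p) | mem-shift a b E∼ (west p)
        | readWord-shift n a b E∼ (south p) | readWord-shift n a b E∼ (west p) = refl

readWord-~ : ∀ n {D E} → D ~ E → NonEmpty D → readWord n E (corner E) ≡ readWord n D (corner D)
readWord-~ n D~E@(a , b , E∼) ne =
  trans (cong (λ B → readWord n _ (top B , right B)) (extent-~ D~E ne)) (readWord-shift n a b E∼ _)

-- q lies weakly south-west of p; reading a word from p inspects only such cells.
infix 4 _⊑_
_⊑_ : Cell → Cell → Set
q ⊑ p = row p ≤ row q × col q ≤ col p

⊑-trans : ∀ {o p q} → q ⊑ p → p ⊑ o → q ⊑ o
⊑-trans (r₁ , c₁) (r₂ , c₂) = ℤ.≤-trans r₂ r₁ , ℤ.≤-trans c₁ c₂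

south-⊑ : ∀ p → south p ⊑ p
south-⊑ (r , _) = ℤ.i≤i+j r (+ 1) , ℤ.≤-refl

west-⊑ : ∀ p → west p ⊑ p
west-⊑ (_ , c) = ℤ.≤-refl , ℤ.i-j≤i c (+ 1)

readWord-local : ∀ n {D E} p → (∀ q → q ⊑ p → mem D q ≡ mem E q) → readWord n D p ≡ readWord n E p
readWord-local zero    p agree = refl
readWord-local (suc n) {D} {E} p agree
  rewrite agree (south p) (south-⊑ p) | agree (west p) (west-⊑ p)
        | readWord-local n {D} {E} (south p) (λ q q⊑ → agree q (⊑-trans q⊑ (south-⊑ p)))
        | readWord-local n {D} {E} (west p) (λ q q⊑ → agree q (⊑-trans q⊑ (west-⊑ p))) = refl

i+1≰i : ∀ i → ¬ (i + + 1 ≤ i)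
i+1≰i i i+1≤i = ℤ.<-irrefl refl (ℤ.suc[i]≤j⇒i<j (subst (_≤ i) (ℤ.+-comm i (+ 1)) i+1≤i))

∈⇒⊑corner : ∀ {D x} → x ∈ D → x ⊑ corner D
∈⇒⊑corner x∈ with hasExtent-extent (_ , x∈)
... | (_ , t≤) , _ , _ , (_ , ≤r) = t≤ _ x∈ , ≤r _ x∈

module _ (w : RibbonWord) where
  private
    R = ribbonDiagram w

  row-headCell-cdot : row (headCell cdot w) + + 1 ≡ topRow R
  row-headCell-cdot = lemma (topRow R)
    where lemma : ∀ t → + 0 + (t - + 1 - + 0) + + 1 ≡ t
          lemma = solve-∀

  col-headCell-odot : col (headCell odot w) ≡ rightCol R + + 1
  col-headCell-odot = lemma (rightCol R)
    where lemma : ∀ r → + 0 + (r + + 1 - + 0) ≡ r + + 1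
          lemma = solve-∀

  south-headCell-cdot : south (headCell cdot w) ≡ corner R
  south-headCell-cdot = cong₂ _,_ row-headCell-cdot (lemma (rightCol R))
    where lemma : ∀ r → + 0 + (r + + 0 - + 0) ≡ r
          lemma = solve-∀

  west-headCell-odot : west (headCell odot w) ≡ corner R
  west-headCell-odot = cong₂ _,_ (lemma (topRow R)) (trans (cong (_- + 1) col-headCell-odot) (lemma′ (rightCol R)))
    where lemma : ∀ t → + 0 + (t - + 0 - + 0) ≡ t
          lemma = solve-∀
          lemma′ : ∀ r → r + + 1 - + 1 ≡ r
          lemma′ = solve-∀

  headCell-⋢corner : ∀ s → ¬ (headCell s w ⊑ corner R)
  headCell-⋢corner cdot (t≤ , _) = i+1≰i (row (headCell cdot w)) (subst (_≤ row (headCell cdot w)) (sym row-headCell-cdot) t≤)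
  headCell-⋢corner odot (_ , ≤r) = i+1≰i (rightCol R) (subst (_≤ rightCol R) col-headCell-odot ≤r)

  south-headCell-odot-∉ : ¬ (south (headCell odot w) ∈ ribbonDiagram (odot ∷ w))
  south-headCell-odot-∉ p with subst (south (headCell odot w) ∈_) (ribbonDiagram-∷ odot w) p
  ... | here eq = i+1≰i (row (headCell odot w)) (ℤ.≤-reflexive (cong row eq))
  ... | there q = i+1≰i (rightCol R) (subst (_≤ rightCol R) col-headCell-odot (proj₂ (∈⇒⊑corner q)))

  mem-corner-∷ : ∀ s → mem (ribbonDiagram (s ∷ w)) (corner R) ≡ true
  mem-corner-∷ s = dec-true (_ ∈? _) (subst (corner R ∈_) (sym (ribbonDiagram-∷ s w)) (there (corner-∈ w)))

  mem-ribbonDiagram-∷ : ∀ s q → q ⊑ corner R → mem (ribbonDiagram (s ∷ w)) q ≡ mem R q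
  mem-ribbonDiagram-∷ s q q⊑ = mem-⇔ drop-head (λ q∈ → subst (q ∈_) (sym (ribbonDiagram-∷ s w)) (there q∈))
    where
    drop-head : q ∈ ribbonDiagram (s ∷ w) → q ∈ R
    drop-head p with subst (q ∈_) (ribbonDiagram-∷ s w) p
    ... | here refl = ⊥-elim (headCell-⋢corner s q⊑)
    ... | there q∈ = q∈

readWord-south : ∀ n {D} p → mem D (south p) ≡ true → readWord (suc n) D p ≡ cdot ∷ readWord n D (south p)
readWord-south n p south∈ rewrite south∈ = refl

readWord-west : ∀ n {D} p → mem D (south p) ≡ false → mem D (west p) ≡ true →
                readWord (suc n) D p ≡ odot ∷ readWord n D (west p)
readWord-west n p south∉ west∈ rewrite south∉ | west∈ = refl

readWord-headCell : ∀ s w n → readWord (suc n) (ribbonDiagram (s ∷ w)) (headCell s w) ≡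
                               s ∷ readWord n (ribbonDiagram (s ∷ w)) (corner (ribbonDiagram w))
readWord-headCell cdot w n =
  trans (readWord-south n (headCell cdot w) (subst (λ p → mem R′ p ≡ true) (sym (south-headCell-cdot w)) (mem-corner-∷ w cdot)))
        (cong (λ p → cdot ∷ readWord n R′ p) (south-headCell-cdot w))
  where R′ = ribbonDiagram (cdot ∷ w)
readWord-headCell odot w n =
  trans (readWord-west n (headCell odot w) (dec-false (_ ∈? R′) (south-headCell-odot-∉ w))
                         (subst (λ p → mem R′ p ≡ true) (sym (west-headCell-odot w)) (mem-corner-∷ w odot)))
        (cong (λ p → odot ∷ readWord n R′ p) (west-headCell-odot w))
  where R′ = ribbonDiagram (odot ∷ w)

readWord-ribbonDiagram : ∀ w k → readWord (length w ℕ.+ k) (ribbonDiagram w) (corner (ribbonDiagram w)) ≡ w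
readWord-ribbonDiagram []      zero    = refl
readWord-ribbonDiagram []      (suc k) = refl
readWord-ribbonDiagram (s ∷ w) k = begin
  readWord (suc n) R′ (corner R′)       ≡⟨ cong (readWord (suc n) R′) (corner-∷ s w) ⟩
  readWord (suc n) R′ (headCell s w)    ≡⟨ readWord-headCell s w n ⟩
  s ∷ readWord n R′ (corner R)          ≡⟨ cong (s ∷_) (readWord-local n (corner R) (mem-ribbonDiagram-∷ w s)) ⟩
  s ∷ readWord n R (corner R)           ≡⟨ cong (s ∷_) (readWord-ribbonDiagram w k) ⟩
  s ∷ w                                 ∎
  where
  open ≡-Reasoning
  n = length w ℕ.+ k
  R = ribbonDiagram w
  R′ = ribbonDiagram (s ∷ w)

ribbon-injective : ∀ {γ δ} → ribbon γ ~ ribbon δ → γ ≡ δ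
ribbon-injective {γ} {δ} γ~δ = begin
  γ                                                ≡⟨ readWord-ribbonDiagram γ (length δ) ⟨
  readWord N Rγ (corner Rγ)                        ≡⟨ readWord-~ N Rγ~Rδ (nonEmpty-ribbonDiagram γ) ⟨
  readWord N Rδ (corner Rδ)                        ≡⟨ cong (λ n → readWord n Rδ (corner Rδ)) (ℕ.+-comm (length γ) (length δ)) ⟩
  readWord (length δ ℕ.+ length γ) Rδ (corner Rδ)  ≡⟨ readWord-ribbonDiagram δ (length γ) ⟩
  δ                                                ∎
  where
  open ≡-Reasoning
  N = length γ ℕ.+ length δ
  Rγ = ribbonDiagram γ
  Rδ = ribbonDiagram δ
  Rγ~Rδ : Rγ ~ Rδ
  Rγ~Rδ = subst₂ _~_ (bulletAux-□ true γ) (bulletAux-□ true δ) γ~δ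

≢[]⇒nonEmpty : ∀ {D} → D ≢ [] → NonEmpty D
≢[]⇒nonEmpty {[]}    D≢[] = ⊥-elim (D≢[] refl)
≢[]⇒nonEmpty {x ∷ _} _    = x , here refl

proposition2p5 : (α β : RibbonWord) (D : Diagram) → IsSkewDiagram D → D ≢ [] →
    (γ : RibbonWord) → ribbon γ ≈ α • ribbon β →
    α • (β • D) ≈ γ • D
proposition2p5 α β D _ D≢[] γ γ≈α•β =
  ~⇒≈ (subst (λ w → α • (β • D) ~ w • D) (sym γ≡α•ʷβ) (•-assoc α β (≢[]⇒nonEmpty D≢[])))
  where
  γ≡α•ʷβ : γ ≡ α •ʷ β
  γ≡α•ʷβ = ribbon-injective (~-trans (≈⇒~ γ≈α•β) (•-assoc α β (nonEmpty-ribbonDiagram [])))
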